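{- For any permutation $\sigma$ (of size $n \geq 1$), there is at least one entry $j$ of $\sigma$ such that the permutation $\tau$ obtained from $\sigma$ by removing $j$ (and standardizing the remaining values to $1,\ldots,n-1$) has at most one more fixpoint than $\sigma$.
   Context: A fixpoint of a permutation $\sigma$ is an index $i$ with $\sigma_i = i$. Removing an entry of value $j$ from $\sigma \in S_n$ and standardizing means deleting it from the word $\sigma_1\ldots\sigma_n$ and replacing each remaining value $v > j$ by $v-1$, yielding a permutation of $S_{n-1}$. -}

module Defs where

open import Data.Nat using (ℕ)
open import Data.Fin using (Fin; _≟_)
open import Data.Fin.Permutation using (Permutation′; _⟨$⟩ʳ_)
open import Data.List using (length; filter)
open import Data.List using () renaming (allFin to allFinL)

fixpoints : (n : ℕ) → Permutation′ n → ℕ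
fixpoints n σ = length (filter (λ i → (σ ⟨$⟩ʳ i) ≟ i) (allFinL n))

-- Write τ for σ with the entry at position i (of value v = σ i) removed. A fixpoint j of τ
-- lifts to the position p = punchIn i j of σ with σ p = punchIn v j, so σ p and p are at
-- most one apart, and p is a fixpoint of σ unless j lies between i and v. If some entry k
-- has σ k at most one apart from k, removing it leaves at most one j between k and σ k;
-- if there is no such entry, no τ has a fixpoint at all.
module Submission where

open import Defs
open import Data.Nat using (ℕ; zero; suc; _≤_; _<_; _+_; _⊓_; _⊔_; _≤?_; z≤n; s≤s)
open import Data.Nat.Properties
  using (≤-refl; ≤-trans; ≤-antisym; ≤-pred; n≤1+n; +-mono-≤; +-mono-<-≤; +-mono-≤-<; +-monoˡ-≤; +-monoʳ-≤; ⊔-lub; ⊓-glb)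
open import Data.Fin using (Fin; zero; suc; toℕ; punchIn; _≟_)
open import Data.Fin.Properties using (toℕ-injective; any?)
open import Data.Fin.Permutation using (Permutation′; _⟨$⟩ʳ_; remove; punchIn-permute)
open import Data.List using (List; []; _∷_; length; filter; tabulate; allFin)
open import Data.List.Relation.Unary.All using (All; []; _∷_)
open import Data.List.Relation.Unary.All.Properties using (all-filter)
open import Data.List.Relation.Unary.AllPairs using ([]; _∷_)
open import Data.List.Relation.Unary.Unique.Propositional using (Unique)
import Data.List.Relation.Unary.Unique.Propositional.Properties as Unique
open import Data.List.Relation.Binary.Pointwise using (tabulate⁺)
open import Data.List.Relation.Binary.Sublist.Heterogeneous using (Sublist; _∷_; _∷ʳ_)
open import Data.List.Relation.Binary.Sublist.Heterogeneous.Properties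
  using (fromPointwise; length-mono-≤; ⊆-filter-Sublist)
open import Data.Product using (∃; _×_; _,_)
open import Data.Sum using (_⊎_; inj₁; inj₂)
open import Function using (id; _∘_)
open import Level using (Level)
open import Relation.Nullary using (yes; no; contradiction)
open import Relation.Nullary.Decidable using (_×-dec_; ¬?)
open import Relation.Unary using (Pred; Decidable)
open import Relation.Binary using (REL)
open import Relation.Binary.PropositionalEquality using (_≡_; _≢_; refl; sym; trans; cong; subst)

private
  variable
    a b p q r : Level
    A B : Set a
    n : ℕ

length-filter-∷ : {P : Pred A p} (P? : Decidable P) (x : A) (xs : List A) →
                  length (filter P? xs) ≤ length (filter P? (x ∷ xs))
length-filter-∷ P? x xs with P? x
... | yes _ = n≤1+n _
... | no  _ = ≤-refl

length-filter-∷-< : {P : Pred A p} (P? : Decidable P) {x : A} → P x → (xs : List A) →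
                    length (filter P? xs) < length (filter P? (x ∷ xs))
length-filter-∷-< P? {x} px xs with P? x
... | yes _   = ≤-refl
... | no  ¬px = contradiction px ¬px

length-filter-⊎ : {P : Pred A p} {Q : Pred A q} {R : Pred A r}
                  (P? : Decidable P) (Q? : Decidable Q) (R? : Decidable R) →
                  (∀ {x} → P x → Q x ⊎ R x) → (xs : List A) →
                  length (filter P? xs) ≤ length (filter Q? xs) + length (filter R? xs)
length-filter-⊎ P? Q? R? P⊆Q∪R []       = z≤n
length-filter-⊎ {Q = Q} {R = R} P? Q? R? P⊆Q∪R (x ∷ xs) with P? x
... | no _ = ≤-trans (length-filter-⊎ P? Q? R? P⊆Q∪R xs)
                     (+-mono-≤ (length-filter-∷ Q? x xs) (length-filter-∷ R? x xs))
... | yes px = ≤-trans (s≤s (length-filter-⊎ P? Q? R? P⊆Q∪R xs)) (grow (P⊆Q∪R px))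
  where
  grow : Q x ⊎ R x → length (filter Q? xs) + length (filter R? xs) <
                      length (filter Q? (x ∷ xs)) + length (filter R? (x ∷ xs))
  grow (inj₁ qx) = +-mono-<-≤ (length-filter-∷-< Q? qx xs) (length-filter-∷ R? x xs)
  grow (inj₂ rx) = +-mono-≤-< (length-filter-∷ Q? x xs) (length-filter-∷-< R? rx xs)

length-filter-≤1 : {P : Pred A p} (P? : Decidable P) → (∀ {x y} → P x → P y → x ≡ y) →
                   {xs : List A} → Unique xs → length (filter P? xs) ≤ 1
length-filter-≤1 {P = P} P? P-unique {xs} u = length≤1 (Unique.filter⁺ P? u) (all-filter P? xs)
  where
  length≤1 : ∀ {ys} → Unique ys → All P ys → length ys ≤ 1
  length≤1 []              []            = z≤n
  length≤1 (_ ∷ [])        _             = s≤s z≤n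
  length≤1 ((x≢y ∷ _) ∷ _) (px ∷ py ∷ _) = contradiction (P-unique px py) x≢y

tabulate-punchIn-Sublist : {R : REL A B r} (i : Fin (suc n)) {f : Fin n → A} {g : Fin (suc n) → B} →
                           (∀ j → R (f j) (g (punchIn i j))) → Sublist R (tabulate f) (tabulate g)
tabulate-punchIn-Sublist zero    {g = g} fRg = g zero ∷ʳ fromPointwise (tabulate⁺ fRg)
tabulate-punchIn-Sublist {n = suc n} (suc i) {f} {g} fRg =
  fRg zero ∷ tabulate-punchIn-Sublist i {f ∘ suc} {g ∘ suc} (fRg ∘ suc)

length-filter-punchIn : {P : Pred (Fin (suc n)) p} (P? : Decidable P) (i : Fin (suc n)) →
                        length (filter (P? ∘ punchIn i) (allFin n)) ≤ length (filter P? (allFin (suc n)))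
length-filter-punchIn P? i = length-mono-≤
  (⊆-filter-Sublist (P? ∘ punchIn i) P? (λ { refl px → px })
    (tabulate-punchIn-Sublist {R = λ j k → punchIn i j ≡ k} i {f = id} {g = id} (λ _ → refl)))

toℕ-punchIn-≥ : (i : Fin (suc n)) (j : Fin n) → toℕ j ≤ toℕ (punchIn i j)
toℕ-punchIn-≥ zero    j       = n≤1+n _
toℕ-punchIn-≥ (suc i) zero    = z≤n
toℕ-punchIn-≥ (suc i) (suc j) = s≤s (toℕ-punchIn-≥ i j)

toℕ-punchIn-≤ : (i : Fin (suc n)) (j : Fin n) → toℕ (punchIn i j) ≤ suc (toℕ j)
toℕ-punchIn-≤ zero    j       = ≤-refl
toℕ-punchIn-≤ (suc i) zero    = z≤n
toℕ-punchIn-≤ (suc i) (suc j) = s≤s (toℕ-punchIn-≤ i j)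

punchIn-≢⇒between : (x y : Fin (suc n)) (j : Fin n) → punchIn x j ≢ punchIn y j →
                    toℕ x ⊓ toℕ y ≤ toℕ j × toℕ j < toℕ x ⊔ toℕ y
punchIn-≢⇒between zero    zero    j       x≢y = contradiction refl x≢y
punchIn-≢⇒between zero    (suc y) zero    x≢y = z≤n , s≤s z≤n
punchIn-≢⇒between zero    (suc y) (suc j) x≢y with punchIn-≢⇒between zero y j (x≢y ∘ cong suc)
... | _ , j<y = z≤n , s≤s j<y
punchIn-≢⇒between (suc x) zero    zero    x≢y = z≤n , s≤s z≤n
punchIn-≢⇒between (suc x) zero    (suc j) x≢y with punchIn-≢⇒between zero x j (x≢y ∘ cong suc ∘ sym)
... | _ , j<x = z≤n , s≤s j<x
punchIn-≢⇒between (suc x) (suc y) zero    x≢y = contradiction refl x≢y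
punchIn-≢⇒between (suc x) (suc y) (suc j) x≢y with punchIn-≢⇒between x y j (x≢y ∘ cong suc)
... | x⊓y≤j , j<x⊔y = s≤s x⊓y≤j , s≤s j<x⊔y

AtMostOneApart : Fin n → Fin n → Set
AtMostOneApart x y = toℕ x ⊔ toℕ y ≤ suc (toℕ x ⊓ toℕ y)

punchIn-atMostOneApart : (x y : Fin (suc n)) (j : Fin n) → AtMostOneApart (punchIn x j) (punchIn y j)
punchIn-atMostOneApart x y j = ≤-trans (⊔-lub (toℕ-punchIn-≤ x j) (toℕ-punchIn-≤ y j))
                                       (s≤s (⊓-glb (toℕ-punchIn-≥ x j) (toℕ-punchIn-≥ y j)))

between-atMostOneApart : {x y : Fin (suc n)} {j : Fin n} → AtMostOneApart x y →
                         toℕ x ⊓ toℕ y ≤ toℕ j → toℕ j < toℕ x ⊔ toℕ y → toℕ j ≡ toℕ x ⊓ toℕ y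
between-atMostOneApart close lower upper = ≤-antisym (≤-pred (≤-trans upper close)) lower

Near : Permutation′ n → Fin n → Set
Near σ k = AtMostOneApart (σ ⟨$⟩ʳ k) k

near? : (σ : Permutation′ n) → Decidable (Near σ)
near? σ k = _ ≤? _

module _ (σ : Permutation′ (suc n)) (i : Fin (suc n)) where

  private
    τ = remove i σ
    v = σ ⟨$⟩ʳ i

  remove-fixpoint : {j : Fin n} → τ ⟨$⟩ʳ j ≡ j → σ ⟨$⟩ʳ punchIn i j ≡ punchIn v j
  remove-fixpoint {j} τj≡j = trans (punchIn-permute σ i j) (cong (punchIn v) τj≡j)

  remove-fixpoint⇒near : {j : Fin n} → τ ⟨$⟩ʳ j ≡ j → Near σ (punchIn i j)
  remove-fixpoint⇒near {j} τj≡j =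
    subst (λ w → AtMostOneApart w (punchIn i j)) (sym (remove-fixpoint τj≡j)) (punchIn-atMostOneApart v i j)

  NewFixpoint : Pred (Fin n) _
  NewFixpoint j = τ ⟨$⟩ʳ j ≡ j × σ ⟨$⟩ʳ punchIn i j ≢ punchIn i j

  newFixpoint? : Decidable NewFixpoint
  newFixpoint? j = (τ ⟨$⟩ʳ j ≟ j) ×-dec ¬? (σ ⟨$⟩ʳ punchIn i j ≟ punchIn i j)

  fixpoints-remove-≤ : fixpoints n τ ≤ fixpoints (suc n) σ + length (filter newFixpoint? (allFin n))
  fixpoints-remove-≤ =
    ≤-trans (length-filter-⊎ (λ j → τ ⟨$⟩ʳ j ≟ j) (fixpoint? ∘ punchIn i) newFixpoint? old-or-new (allFin n))
            (+-monoˡ-≤ _ (length-filter-punchIn fixpoint? i))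
    where
    fixpoint? : Decidable (λ k → σ ⟨$⟩ʳ k ≡ k)
    fixpoint? k = σ ⟨$⟩ʳ k ≟ k

    old-or-new : ∀ {j} → τ ⟨$⟩ʳ j ≡ j → σ ⟨$⟩ʳ punchIn i j ≡ punchIn i j ⊎ NewFixpoint j
    old-or-new {j} τj≡j with fixpoint? (punchIn i j)
    ... | yes old = inj₁ old
    ... | no  new = inj₂ (τj≡j , new)

  near⇒newFixpoint-unique : Near σ i → ∀ {j k} → NewFixpoint j → NewFixpoint k → j ≡ k
  near⇒newFixpoint-unique near new-j new-k = toℕ-injective (trans (position new-j) (sym (position new-k)))
    where
    position : ∀ {j} → NewFixpoint j → toℕ j ≡ toℕ v ⊓ toℕ i
    position (τj≡j , σp≢p) with punchIn-≢⇒between v i _ (σp≢p ∘ trans (remove-fixpoint τj≡j))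
    ... | lower , upper = between-atMostOneApart near lower upper

  fixpoints-remove-≤+1 : (∀ {j k} → NewFixpoint j → NewFixpoint k → j ≡ k) →
                          fixpoints n τ ≤ fixpoints (suc n) σ + 1
  fixpoints-remove-≤+1 new-unique = ≤-trans fixpoints-remove-≤
    (+-monoʳ-≤ _ (length-filter-≤1 newFixpoint? new-unique (Unique.allFin⁺ n)))

lemma2 : (n : ℕ) (σ : Permutation′ (suc n)) →
    ∃ λ (i : Fin (suc n)) → fixpoints n (remove i σ) ≤ fixpoints (suc n) σ + 1
lemma2 n σ with any? (near? σ)
... | yes (i , near) = i , fixpoints-remove-≤+1 σ i (near⇒newFixpoint-unique σ i near)
... | no  no-near    = zero , fixpoints-remove-≤+1 σ zero
  λ (τj≡j , _) _ → contradiction (_ , remove-fixpoint⇒near σ zero τj≡j) no-near
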